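{- For $n\geq 2$, $|\hat{\mathcal{B}}_n(2121)|=\sum_{k=1}^{n-1}k^{n-k-1}$.
   Context: An endofunction of size $n$ is a word $x=x_1\cdots x_n$ with entries in $\{1,\dots,n\}$; it is a Cayley permutation if it contains every integer between $1$ and $\max(x)$. Let $\mathrm{Ascbot}(x)=\{1\}\cup\{i:1\leq i\leq n-1,\ x_i<x_{i+1}\}$ and $\mathrm{Nub}(x)$ the set of indices $i$ such that $x_i$ is the leftmost occurrence of its value. A revised ascent sequence of length $n$ is a Cayley permutation $x$ of length $n$ with $\mathrm{Ascbot}(x)=\mathrm{Nub}(x)$. For Cayley permutations $x$ and $\sigma=\sigma_1\cdots\sigma_k$, $x$ contains $\sigma$ if there are indices $i_1<\cdots<i_k$ such that for all $s,t$: $x_{i_s}<x_{i_t}\iff\sigma_s<\sigma_t$ and $x_{i_s}=x_{i_t}\iff\sigma_s=\sigma_t$; otherwise $x$ avoids $\sigma$. $\hat{\mathcal{B}}_n(\sigma)$ is the set of revised ascent sequences of length $n$ avoiding $\sigma$. -}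

module Defs where

open import Data.Nat using (ℕ; zero; suc; _+_; _*_; _∸_; _^_; _<ᵇ_; _≡ᵇ_)
open import Data.Bool using (Bool; true; false; _∧_; _∨_; not; if_then_else_)
open import Data.List using (List; []; _∷_; map; concatMap; filter; length; foldr; upTo; applyUpTo)
open import Data.Bool.ListAction using (all; any)
open import Data.Nat.ListAction using (sum)
open import Data.Product using (_×_; _,_)
open import Relation.Nullary.Decidable using (Dec; yes; no)
open import Relation.Binary.PropositionalEquality using (_≡_)
open import Data.Bool using (T)
open import Relation.Nullary.Decidable using (does)
import Data.Bool.Properties as BP

-- Words are lists of natural numbers; values are 1-based as in the paper.

words : ℕ → ℕ → List (List ℕ)
words zero    n = [] ∷ []
words (suc k) n = concatMap (λ w → map (λ a → a ∷ w) (applyUpTo suc n)) (words k n)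

Endo : ℕ → List (List ℕ)
Endo n = words n n

maxL : List ℕ → ℕ
maxL = foldr Data.Nat._⊔_ 0

memb : ℕ → List ℕ → Bool
memb a = any (λ b → a ≡ᵇ b)

isCayley : List ℕ → Bool
isCayley x = all (λ v → memb v x) (applyUpTo suc (maxL x))

indexed : List ℕ → List (ℕ × ℕ)
indexed = go 1
  where
  go : ℕ → List ℕ → List (ℕ × ℕ)
  go i []       = []
  go i (a ∷ as) = (i , a) ∷ go (suc i) as

-- Ascbot(x) = {1} ∪ {i : 1 ≤ i ≤ n-1, x_i < x_{i+1}}, as a membership test
inAscbot : List ℕ → ℕ → Bool
inAscbot x i = (i ≡ᵇ 1) ∨ go 1 x
  where
  go : ℕ → List ℕ → Bool
  go j []            = false
  go j (a ∷ [])      = false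
  go j (a ∷ b ∷ bs)  = ((j ≡ᵇ i) ∧ (a <ᵇ b)) ∨ go (suc j) (b ∷ bs)

-- Nub(x): indices i such that x_i is the leftmost occurrence of its value
inNub : List ℕ → ℕ → Bool
inNub x i = go 1 [] x
  where
  go : ℕ → List ℕ → List ℕ → Bool
  go j seen []       = false
  go j seen (a ∷ as) = ((j ≡ᵇ i) ∧ not (memb a seen)) ∨ go (suc j) (a ∷ seen) as

-- Ascbot(x) = Nub(x) as subsets of {1,…,length x}
-- (both sets are contained in {1,…,n} when n ≥ 1)
ascbotEqNub : List ℕ → Bool
ascbotEqNub x = all (λ i → inAscbot x i ≡ᵇᵇ inNub x i) (applyUpTo suc (length x))
  where
  _≡ᵇᵇ_ : Bool → Bool → Bool
  a ≡ᵇᵇ b = does (a BP.≟ b)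

isRevisedAscentSeq : List ℕ → Bool
isRevisedAscentSeq x = isCayley x ∧ ascbotEqNub x

subseqs : ℕ → List ℕ → List (List ℕ)
subseqs zero    xs       = [] ∷ []
subseqs (suc k) []       = []
subseqs (suc k) (a ∷ as) = map (a ∷_) (subseqs k as) Data.List.++ subseqs (suc k) as

orderIso : List ℕ → List ℕ → Bool
orderIso y σ = (length y ≡ᵇ length σ) ∧
  all (λ p → all (λ q → agree p q) ys) ys
  where
  ys = zipL y σ
    where
    zipL : List ℕ → List ℕ → List (ℕ × ℕ)
    zipL (a ∷ as) (b ∷ bs) = (a , b) ∷ zipL as bs
    zipL _ _ = []
  eqB : Bool → Bool → Bool
  eqB a b = does (a BP.≟ b)
  agree : ℕ × ℕ → ℕ × ℕ → Bool
  agree (a , b) (c , d) = eqB (a <ᵇ c) (b <ᵇ d) ∧ eqB (a ≡ᵇ c) (b ≡ᵇ d)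

contains : List ℕ → List ℕ → Bool
contains x σ = any (λ y → orderIso y σ) (subseqs (length σ) x)

avoids : List ℕ → List ℕ → Bool
avoids x σ = not (contains x σ)

Bhat : ℕ → List ℕ → List (List ℕ)
Bhat n σ = filter (λ x → T? (isRevisedAscentSeq x ∧ avoids x σ)) (Endo n)
  where
  T? : (b : Bool) → Dec (T b)
  T? = Data.Bool.T?

sumFrom1 : ℕ → (ℕ → ℕ) → ℕ
sumFrom1 m f = sum (applyUpTo (λ i → f (suc i)) m)

-- A revised ascent sequence x avoiding 2121 starts with its maximum M, and each smaller value
-- occurs in it at most once: if a < M first occurs at a position s > 1, then s is an ascent
-- bottom, and if a occurred again at q > s, the largest entry b strictly between s and q would
-- have its first occurrence before s (a first occurrence inside the segment would ascend above
-- b), so that b a b a would be an occurrence of 2121. Hence every entry below M is a first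
-- occurrence and so an ascent bottom: x = M w, where w consists of G blocks, each a strictly
-- increasing run of values below M closed by a copy of M, and every value 1, …, M − 1 occurs
-- exactly once. Conversely every such word is a 2121-avoiding revised ascent sequence. With
-- n = M + G, such a w amounts to an arbitrary assignment of the n − G − 1 values below M to
-- the G blocks, so there are G^(n−G−1) sequences for each 1 ≤ G ≤ n − 1.

module Submission where

open import Defs
open import Data.Nat
  using (ℕ; zero; suc; pred; _+_; _*_; _^_; _∸_; _≤_; _<_; _≟_; _≤?_; _<?_; _≡ᵇ_; _<ᵇ_;
         z≤n; s≤s; z<s; s<s)
open import Data.Nat.Properties
open import Data.Nat.ListAction using (sum)
open import Data.Bool using (Bool; true; false; T; not; _∧_; _∨_)
import Data.Bool as Bool
open import Data.Bool.ListAction using (all)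
open import Data.Bool.Properties using (T-≡; T-∧; T-∨; ∨-identityʳ; ∨-comm; ∨-assoc)
open import Data.List
  using (List; []; _∷_; [_]; _++_; length; map; concatMap; applyUpTo; replicate; take; drop;
         cartesianProductWith)
open import Data.List.Properties
  using (length-++; length-map; length-applyUpTo; length-replicate; length-++-sucʳ; map-applyUpTo;
         map-cong; ∷-injective)
open import Data.List.Membership.Propositional using (_∈_; _∉_; lose; find)
open import Data.List.Membership.Propositional.Properties
  using (∈-∃++; ∈-++⁻; ∈-++⁺ˡ; ∈-++⁺ʳ; ∈-map⁺; ∈-map⁻; ∈-concatMap⁺; ∈-concatMap⁻; ∈-applyUpTo⁺;
         ∈-applyUpTo⁻; ∈-cartesianProductWith⁺; ∈-cartesianProductWith⁻; ∈-filter⁺; ∈-filter⁻)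
open import Data.List.Relation.Unary.All as All using (All; []; _∷_)
import Data.List.Relation.Unary.All.Properties as All
open import Data.List.Relation.Unary.Any as Any using (here; there)
import Data.List.Relation.Unary.Any.Properties as Any
open import Data.List.Relation.Unary.AllPairs as AllPairs using (AllPairs; []; _∷_)
import Data.List.Relation.Unary.AllPairs.Properties as AllPairs
open import Data.List.Relation.Unary.Unique.Propositional using (Unique)
import Data.List.Relation.Unary.Unique.Propositional.Properties as Unique
open import Data.List.Relation.Binary.Subset.Propositional using (_⊆_)
open import Data.Product using (∃; ∃₂; _×_; _,_; proj₁; proj₂; map₁)
open import Data.Sum as Sum using (_⊎_; inj₁; inj₂; [_,_]′)
open import Data.Empty using (⊥; ⊥-elim)
open import Relation.Nullary using (¬_; Dec; yes; no; does)
open import Function using (_∘_; _⇔_; mk⇔; Equivalence)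
open import Relation.Binary.PropositionalEquality
  using (_≡_; _≢_; refl; sym; trans; cong; cong₂; subst; module ≡-Reasoning)

-- Duplicate-free lists and their lengths

module _ {A : Set} where

  AllPairs-mapWith∈ : ∀ {R S : A → A → Set} {xs} →
    (∀ {x y} → x ∈ xs → y ∈ xs → R x y → S x y) → AllPairs R xs → AllPairs S xs
  AllPairs-mapWith∈ f [] = []
  AllPairs-mapWith∈ f (r ∷ rs) =
    All.tabulate (λ y∈ → f (here refl) (there y∈) (All.lookup r y∈)) ∷
    AllPairs-mapWith∈ (λ x∈ y∈ → f (there x∈) (there y∈)) rs

  Unique-map⁺ : ∀ {B : Set} {f : A → B} {xs} →
    (∀ {x y} → x ∈ xs → y ∈ xs → f x ≡ f y → x ≡ y) → Unique xs → Unique (map f xs)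
  Unique-map⁺ inj u = AllPairs.map⁺ (AllPairs-mapWith∈ (λ x∈ y∈ x≢y → x≢y ∘ inj x∈ y∈) u)

  Unique-concatMap⁺ : ∀ {B : Set} {f : A → List B} {xs} →
    (∀ {x} → x ∈ xs → Unique (f x)) →
    (∀ {x y z} → x ∈ xs → y ∈ xs → z ∈ f x → z ∈ f y → x ≡ y) →
    Unique xs → Unique (concatMap f xs)
  Unique-concatMap⁺ uf disjoint u = Unique.concat⁺
    (All.map⁺ (All.tabulate uf))
    (AllPairs.map⁺ (AllPairs-mapWith∈ (λ x∈ y∈ x≢y (z∈ , z∈′) → x≢y (disjoint x∈ y∈ z∈ z∈′)) u))

  ∈-++-removeMiddle : ∀ {v x : A} us {vs} → v ∈ us ++ x ∷ vs → v ≢ x → v ∈ us ++ vs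
  ∈-++-removeMiddle us v∈ v≢x with ∈-++⁻ us v∈
  ... | inj₁ v∈us         = ∈-++⁺ˡ v∈us
  ... | inj₂ (here v≡x)   = ⊥-elim (v≢x v≡x)
  ... | inj₂ (there v∈vs) = ∈-++⁺ʳ us v∈vs

  All-middle⁺ : ∀ {P : A → Set} xs {a ys} → P a → All P (xs ++ ys) → All P (xs ++ a ∷ ys)
  All-middle⁺ xs pa all = All.++⁺ (All.++⁻ˡ xs all) (pa ∷ All.++⁻ʳ xs all)

  All-middle⁻ : ∀ {P : A → Set} xs {a ys} → All P (xs ++ a ∷ ys) → All P (xs ++ ys)
  All-middle⁻ xs all = All.++⁺ (All.++⁻ˡ xs all) (All.tail (All.++⁻ʳ xs all))

  Unique-⊆⇒length≤ : ∀ {xs ys : List A} → Unique xs → xs ⊆ ys → length xs ≤ length ys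
  Unique-⊆⇒length≤ {[]}     _           _     = z≤n
  Unique-⊆⇒length≤ {x ∷ xs} (x∉xs ∷ u) xs⊆ys with ∈-∃++ (xs⊆ys (here refl))
  ... | us , vs , refl = subst (suc (length xs) ≤_) (sym (length-++-sucʳ us x vs))
    (s≤s (Unique-⊆⇒length≤ u λ z∈ → ∈-++-removeMiddle us (xs⊆ys (there z∈)) (All.lookup x∉xs z∈ ∘ sym)))

  Unique-⊆-antisym⇒length≡ : ∀ {xs ys : List A} → Unique xs → Unique ys → xs ⊆ ys → ys ⊆ xs →
    length xs ≡ length ys
  Unique-⊆-antisym⇒length≡ uxs uys xs⊆ys ys⊆xs =
    ≤-antisym (Unique-⊆⇒length≤ uxs xs⊆ys) (Unique-⊆⇒length≤ uys ys⊆xs)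

  length-concatMap : ∀ {B : Set} (f : A → List B) xs →
    length (concatMap f xs) ≡ sum (map (length ∘ f) xs)
  length-concatMap f []       = refl
  length-concatMap f (x ∷ xs) = trans (length-++ (f x)) (cong (length (f x) +_) (length-concatMap f xs))

  length-cartesianProductWith : ∀ {B C : Set} (f : A → B → C) xs ys →
    length (cartesianProductWith f xs ys) ≡ length xs * length ys
  length-cartesianProductWith f []       ys = refl
  length-cartesianProductWith f (x ∷ xs) ys = begin
    length (map (f x) ys ++ cartesianProductWith f xs ys)  ≡⟨ length-++ (map (f x) ys) ⟩
    length (map (f x) ys) + length (cartesianProductWith f xs ys)
      ≡⟨ cong₂ _+_ (length-map (f x) ys) (length-cartesianProductWith f xs ys) ⟩
    length ys + length xs * length ys  ∎
    where open ≡-Reasoning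

  concatMap-map≡cartesianProductWith : ∀ {B C : Set} (f : A → B → C) xs ys →
    concatMap (λ x → map (f x) ys) xs ≡ cartesianProductWith f xs ys
  concatMap-map≡cartesianProductWith f []       ys = refl
  concatMap-map≡cartesianProductWith f (x ∷ xs) ys =
    cong (map (f x) ys ++_) (concatMap-map≡cartesianProductWith f xs ys)

-- Words over 1, …, N

InRange : ℕ → ℕ → Set
InRange N a = 1 ≤ a × a ≤ N

∈-applyUpTo-suc⁻ : ∀ {N a} → a ∈ applyUpTo suc N → InRange N a
∈-applyUpTo-suc⁻ a∈ with ∈-applyUpTo⁻ suc a∈
... | _ , i<N , refl = s≤s z≤n , i<N

∈-applyUpTo-suc⁺ : ∀ {N a} → InRange N a → a ∈ applyUpTo suc N
∈-applyUpTo-suc⁺ {a = suc a} (_ , a<N) = ∈-applyUpTo⁺ suc a<N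

words-suc : ∀ k N → words (suc k) N ≡ cartesianProductWith (λ w a → a ∷ w) (words k N) (applyUpTo suc N)
words-suc k N = concatMap-map≡cartesianProductWith _ (words k N) (applyUpTo suc N)

∈-words⁻ : ∀ k N {x} → x ∈ words k N → length x ≡ k × All (InRange N) x
∈-words⁻ zero    N (here refl) = refl , []
∈-words⁻ (suc k) N x∈ with ∈-cartesianProductWith⁻ _ (words k N) _ (subst (_ ∈_) (words-suc k N) x∈)
... | w , a , w∈ , a∈ , refl with ∈-words⁻ k N w∈
... | refl , ws = refl , ∈-applyUpTo-suc⁻ a∈ ∷ ws

∈-words⁺ : ∀ {N} x → All (InRange N) x → x ∈ words (length x) N
∈-words⁺ []      []        = here refl
∈-words⁺ (a ∷ x) (a∈ ∷ x∈) = subst (_ ∈_) (sym (words-suc (length x) _))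
  (∈-cartesianProductWith⁺ (λ w a → a ∷ w) (∈-words⁺ x x∈) (∈-applyUpTo-suc⁺ a∈))

Unique-words : ∀ k N → Unique (words k N)
Unique-words zero    N = [] ∷ []
Unique-words (suc k) N = subst Unique (sym (words-suc k N))
  (Unique.cartesianProductWith⁺ _ (λ e → let a≡b , w≡v = ∷-injective e in w≡v , a≡b)
    (Unique-words k N) (Unique.applyUpTo⁺₁ suc N (λ i<j _ → <⇒≢ i<j ∘ suc-injective)))

length-words : ∀ k N → length (words k N) ≡ N ^ k
length-words zero    N = refl
length-words (suc k) N = begin
  length (words (suc k) N)                  ≡⟨ cong length (words-suc k N) ⟩
  length (cartesianProductWith _ (words k N) (applyUpTo suc N))
    ≡⟨ length-cartesianProductWith _ (words k N) (applyUpTo suc N) ⟩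
  length (words k N) * length (applyUpTo suc N)
    ≡⟨ cong₂ _*_ (length-words k N) (length-applyUpTo suc N) ⟩
  N ^ k * N                                 ≡⟨ *-comm (N ^ k) N ⟩
  N ^ suc k                                 ∎
  where open ≡-Reasoning

-- Positions and occurrences

infixl 9 _!_

-- 0-based lookup, with the junk value 0 beyond the end of the list.
_!_ : List ℕ → ℕ → ℕ
[]      ! _     = 0
(a ∷ w) ! zero  = a
(a ∷ w) ! suc t = w ! t

!-∈ : ∀ w {s} → s < length w → w ! s ∈ w
!-∈ (a ∷ w) {zero}  _         = here refl
!-∈ (a ∷ w) {suc s} (s<s s<n) = there (!-∈ w s<n)

All-!-≤ : ∀ {M} w → All (_≤ M) w → ∀ s → w ! s ≤ M
All-!-≤ []      []         s       = z≤n
All-!-≤ (a ∷ w) (a≤ ∷ _)   zero    = a≤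
All-!-≤ (a ∷ w) (_ ∷ w≤)   (suc s) = All-!-≤ w w≤ s

∈⇒position : ∀ {v w} → v ∈ w → ∃ λ s → s < length w × w ! s ≡ v
∈⇒position (here refl) = 0 , z<s , refl
∈⇒position (there v∈) with ∈⇒position v∈
... | s , s<n , w!s≡v = suc s , s<s s<n , w!s≡v

∈-take⇒position : ∀ {v} x t → v ∈ take t x → ∃ λ s → s < t × x ! s ≡ v
∈-take⇒position (a ∷ x) (suc t) (here refl) = 0 , z<s , refl
∈-take⇒position (a ∷ x) (suc t) (there v∈) with ∈-take⇒position x t v∈
... | s , s<t , x!s≡v = suc s , s<s s<t , x!s≡v

FirstOccurrence : List ℕ → ℕ → Set
FirstOccurrence x t = ∀ s → s < t → x ! s ≢ x ! t

Ascent : List ℕ → ℕ → Set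
Ascent x t = suc t < length x × x ! t < x ! suc t

least-or-none : ∀ {P : ℕ → Set} → (∀ n → Dec (P n)) → ∀ t →
  (∃ λ s → s ≤ t × P s × (∀ s′ → s′ < s → ¬ P s′)) ⊎ (∀ s → s ≤ t → ¬ P s)
least-or-none P? zero with P? 0
... | yes p0 = inj₁ (0 , z≤n , p0 , λ _ ())
... | no ¬p0 = inj₂ λ { zero _ → ¬p0 }
least-or-none P? (suc t) with least-or-none P? t
... | inj₁ (s , s≤t , ps , below) = inj₁ (s , m≤n⇒m≤1+n s≤t , ps , below)
... | inj₂ none with P? (suc t)
...   | yes pt = inj₁ (suc t , ≤-refl , pt , λ s′ s′<1+t → none s′ (m<1+n⇒m≤n s′<1+t))
...   | no ¬pt = inj₂ λ s s≤1+t →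
  [ (λ s<1+t → none s (m<1+n⇒m≤n s<1+t)) , (λ { refl → ¬pt }) ]′ (m≤n⇒m<n∨m≡n s≤1+t)

first-occurrence : ∀ x t → ∃ λ s → s ≤ t × x ! s ≡ x ! t × FirstOccurrence x s
first-occurrence x t with least-or-none (λ s → x ! s ≟ x ! t) t
... | inj₂ none = ⊥-elim (none t ≤-refl refl)
... | inj₁ (s , s≤t , x!s≡x!t , below) =
  s , s≤t , x!s≡x!t , λ s′ s′<s x!s′≡x!s → below s′ s′<s (trans x!s′≡x!s x!s≡x!t)

segment-argmax : ∀ (f : ℕ → ℕ) lo hi → lo ≤ hi →
  ∃ λ r → lo ≤ r × r ≤ hi × (∀ t → lo ≤ t → t ≤ hi → f t ≤ f r)
segment-argmax f lo hi lo≤hi with m≤n⇒m<n∨m≡n lo≤hi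
... | inj₂ refl = lo , ≤-refl , ≤-refl , λ t lo≤t t≤lo → ≤-reflexive (cong f (≤-antisym t≤lo lo≤t))
segment-argmax f lo (suc hi) _ | inj₁ lo<1+hi
  with segment-argmax f lo hi (m<1+n⇒m≤n lo<1+hi)
... | r , lo≤r , r≤hi , f≤fr with f (suc hi) ≤? f r
...   | yes fhi≤fr = r , lo≤r , m≤n⇒m≤1+n r≤hi , λ t lo≤t t≤1+hi →
  [ (λ t<1+hi → f≤fr t lo≤t (m<1+n⇒m≤n t<1+hi)) , (λ { refl → fhi≤fr }) ]′ (m≤n⇒m<n∨m≡n t≤1+hi)
...   | no  fhi≰fr = suc hi , m≤n⇒m≤1+n (≤-trans lo≤r r≤hi) , ≤-refl , λ t lo≤t t≤1+hi →
  [ (λ t<1+hi → ≤-trans (f≤fr t lo≤t (m<1+n⇒m≤n t<1+hi)) (<⇒≤ (≰⇒> fhi≰fr))) , (λ { refl → ≤-refl }) ]′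
    (m≤n⇒m<n∨m≡n t≤1+hi)

count : ℕ → List ℕ → ℕ
count v []      = 0
count v (b ∷ w) with v ≟ b
... | yes _ = suc (count v w)
... | no  _ = count v w

count-here : ∀ v w → count v (v ∷ w) ≡ suc (count v w)
count-here v w with v ≟ v
... | yes _  = refl
... | no v≢v = ⊥-elim (v≢v refl)

count-there : ∀ {v b} w → v ≢ b → count v (b ∷ w) ≡ count v w
count-there {v} {b} w v≢b with v ≟ b
... | yes v≡b = ⊥-elim (v≢b v≡b)
... | no  _   = refl

count-++ : ∀ v xs ys → count v (xs ++ ys) ≡ count v xs + count v ys
count-++ v []       ys = refl
count-++ v (b ∷ xs) ys with v ≟ b
... | yes _ = cong suc (count-++ v xs ys)
... | no  _ = count-++ v xs ys

count-middle : ∀ {v a} xs ys → v ≢ a → count v (xs ++ a ∷ ys) ≡ count v (xs ++ ys)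
count-middle {v} xs ys v≢a = begin
  count v (xs ++ _ ∷ ys)         ≡⟨ count-++ v xs _ ⟩
  count v xs + count v (_ ∷ ys)  ≡⟨ cong (count v xs +_) (count-there ys v≢a) ⟩
  count v xs + count v ys        ≡⟨ count-++ v xs ys ⟨
  count v (xs ++ ys)             ∎
  where open ≡-Reasoning

count≡0⁺ : ∀ {v} w → All (v ≢_) w → count v w ≡ 0
count≡0⁺ []      []            = refl
count≡0⁺ (b ∷ w) (v≢b ∷ v∉w) = trans (count-there w v≢b) (count≡0⁺ w v∉w)

count≡0⁻ : ∀ {v} w → count v w ≡ 0 → All (v ≢_) w
count≡0⁻ []      _ = []
count≡0⁻ {v} (b ∷ w) c≡0 with v ≟ b
... | no v≢b = v≢b ∷ count≡0⁻ w c≡0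

count>0⇒∈ : ∀ {v} w → 1 ≤ count v w → v ∈ w
count>0⇒∈ {v} (b ∷ w) c>0 with v ≟ b
... | yes refl = here refl
... | no  _    = there (count>0⇒∈ w c>0)

∈⇒count>0 : ∀ {v} w → v ∈ w → 1 ≤ count v w
∈⇒count>0 {v} (b ∷ w) v∈ with v ≟ b | v∈
... | yes _   | _          = s≤s z≤n
... | no  v≢b | here v≡b   = ⊥-elim (v≢b v≡b)
... | no  _   | there v∈w = ∈⇒count>0 w v∈w

count≥2⇒positions : ∀ {v} w → 2 ≤ count v w →
  ∃₂ λ p q → p < q × q < length w × w ! p ≡ v × w ! q ≡ v
count≥2⇒positions {v} (b ∷ w) c≥2 with v ≟ b
... | yes refl with ∈⇒position (count>0⇒∈ w (≤-pred c≥2))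
...   | q , q<n , w!q≡v = 0 , suc q , z<s , s<s q<n , refl , w!q≡v
count≥2⇒positions {v} (b ∷ w) c≥2 | no _ with count≥2⇒positions w c≥2
... | p , q , p<q , q<n , e₁ , e₂ = suc p , suc q , s<s p<q , s<s q<n , e₁ , e₂

positions⇒count≥2 : ∀ {v} w {p q} → p < q → q < length w → w ! p ≡ v → w ! q ≡ v → 2 ≤ count v w
positions⇒count≥2 (b ∷ w) {zero} {suc q} _ (s<s q<n) refl w!q≡b =
  subst (2 ≤_) (sym (count-here b w)) (s≤s (∈⇒count>0 w (subst (_∈ w) w!q≡b (!-∈ w q<n))))
positions⇒count≥2 {v} (b ∷ w) {suc p} {suc q} (s<s p<q) (s<s q<n) e₁ e₂ with v ≟ b
... | yes _ = m≤n⇒m≤1+n (positions⇒count≥2 w p<q q<n e₁ e₂)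
... | no  _ = positions⇒count≥2 w p<q q<n e₁ e₂

count-middle-here : ∀ v xs ys → count v (xs ++ v ∷ ys) ≡ suc (count v (xs ++ ys))
count-middle-here v xs ys = begin
  count v (xs ++ v ∷ ys)              ≡⟨ count-++ v xs (v ∷ ys) ⟩
  count v xs + count v (v ∷ ys)       ≡⟨ cong (count v xs +_) (count-here v ys) ⟩
  count v xs + suc (count v ys)       ≡⟨ +-suc (count v xs) (count v ys) ⟩
  suc (count v xs + count v ys)       ≡⟨ cong suc (count-++ v xs ys) ⟨
  suc (count v (xs ++ ys))            ∎
  where open ≡-Reasoning

count-replicate : ∀ G M → count M (replicate G M) ≡ G
count-replicate zero    M = refl
count-replicate (suc G) M = trans (count-here M (replicate G M)) (cong suc (count-replicate G M))

split-at-occurrence : ∀ M c w → 1 ≤ c → c ≤ count M w →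
  ∃₂ λ w₁ w₂ → w ≡ w₁ ++ M ∷ w₂ × suc (count M w₁) ≡ c
split-at-occurrence M (suc c) []      _   ()
split-at-occurrence M c (b ∷ w) 1≤c c≤count with M ≟ b
split-at-occurrence M (suc zero)    (b ∷ w) _ _             | yes refl = [] , w , refl , refl
split-at-occurrence M (suc (suc c)) (b ∷ w) _ (s≤s c≤count) | yes refl
  with split-at-occurrence M (suc c) w (s≤s z≤n) c≤count
... | w₁ , w₂ , refl , c≡ = M ∷ w₁ , w₂ , refl , trans (cong suc (count-here M w₁)) (cong suc c≡)
split-at-occurrence M c (b ∷ w) 1≤c c≤count | no M≢b with split-at-occurrence M c w 1≤c c≤count
... | w₁ , w₂ , refl , c≡ = b ∷ w₁ , w₂ , refl , trans (cong suc (count-there w₁ M≢b)) c≡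

-- Boolean tests read as propositions

T⇒≡true : ∀ {b} → T b → b ≡ true
T⇒≡true = Equivalence.to T-≡

¬T⇒≡false : ∀ {b} → ¬ T b → b ≡ false
¬T⇒≡false {false} _  = refl
¬T⇒≡false {true}  ¬t = ⊥-elim (¬t _)

T-not⁺ : ∀ {b} → ¬ T b → T (not b)
T-not⁺ {false} _  = _
T-not⁺ {true}  ¬t = ¬t _

T-not⁻ : ∀ {b} → T (not b) → ¬ T b
T-not⁻ {false} _ ()

T-⇔⇒≡ : ∀ {a b} → (T a → T b) → (T b → T a) → a ≡ b
T-⇔⇒≡ {false} {false} _ _ = refl
T-⇔⇒≡ {false} {true}  _ f = ⊥-elim (f _)
T-⇔⇒≡ {true}  {false} f _ = ⊥-elim (f _)
T-⇔⇒≡ {true}  {true}  _ _ = refl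

T-does-≟⇒≡ : ∀ {a b} → T (does (a Bool.≟ b)) → a ≡ b
T-does-≟⇒≡ {false} {false} _ = refl
T-does-≟⇒≡ {true}  {true}  _ = refl

≡⇒T-does-≟ : ∀ {a b} → a ≡ b → T (does (a Bool.≟ b))
≡⇒T-does-≟ {false} refl = _
≡⇒T-does-≟ {true}  refl = _

≡ᵇ-refl : ∀ n → (n ≡ᵇ n) ≡ true
≡ᵇ-refl n = T⇒≡true (≡⇒≡ᵇ n n refl)

≡ᵇ-≢ : ∀ {m n} → m ≢ n → (m ≡ᵇ n) ≡ false
≡ᵇ-≢ {m} {n} m≢n = ¬T⇒≡false (m≢n ∘ ≡ᵇ⇒≡ m n)

<ᵇ-< : ∀ {m n} → m < n → (m <ᵇ n) ≡ true
<ᵇ-< m<n = T⇒≡true (<⇒<ᵇ m<n)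

<ᵇ-≥ : ∀ {m n} → n ≤ m → (m <ᵇ n) ≡ false
<ᵇ-≥ {m} {n} n≤m = ¬T⇒≡false (λ m<ᵇn → <⇒≱ (<ᵇ⇒< m n m<ᵇn) n≤m)

memb⇔∈ : ∀ {a xs} → T (memb a xs) ⇔ a ∈ xs
memb⇔∈ {a} {xs} = mk⇔
  (Any.map (≡ᵇ⇒≡ a _) ∘ Any.any⁻ (a ≡ᵇ_) xs)
  (Any.any⁺ (a ≡ᵇ_) ∘ Any.map (≡⇒≡ᵇ a _))

-- `inAscbot` and `inNub` scan the word with local loops that cannot be named, but a loop is
-- determined by its defining equations. In `inAscbot≡ascentLoop` and `inNub≡nubLoop` the
-- `with`-abstractions turn the arguments of the local loop into fresh variables, so that
-- unification can instantiate the argument `_` of the uniqueness lemma with the local loop.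

ascentLoop : ℕ → ℕ → List ℕ → Bool
ascentLoop i j []           = false
ascentLoop i j (a ∷ [])     = false
ascentLoop i j (a ∷ b ∷ bs) = ((j ≡ᵇ i) ∧ (a <ᵇ b)) ∨ ascentLoop i (suc j) (b ∷ bs)

ascentLoop-unique : ∀ i (g : ℕ → List ℕ → Bool) →
  (∀ j → g j [] ≡ false) → (∀ j a → g j (a ∷ []) ≡ false) →
  (∀ j a b bs → g j (a ∷ b ∷ bs) ≡ (((j ≡ᵇ i) ∧ (a <ᵇ b)) ∨ g (suc j) (b ∷ bs))) →
  ∀ j ys → g j ys ≡ ascentLoop i j ys
ascentLoop-unique i g e₀ e₁ e₂ j []           = e₀ j
ascentLoop-unique i g e₀ e₁ e₂ j (a ∷ [])     = e₁ j a
ascentLoop-unique i g e₀ e₁ e₂ j (a ∷ b ∷ bs) =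
  trans (e₂ j a b bs) (cong (((j ≡ᵇ i) ∧ (a <ᵇ b)) ∨_) (ascentLoop-unique i g e₀ e₁ e₂ (suc j) (b ∷ bs)))

inAscbot≡ascentLoop : ∀ x i → inAscbot x i ≡ ((i ≡ᵇ 1) ∨ ascentLoop i 1 x)
inAscbot≡ascentLoop x i with ascentLoop-unique i _ (λ _ → refl) (λ _ _ → refl) (λ _ _ _ _ → refl)
inAscbot≡ascentLoop []                  i | _     = refl
inAscbot≡ascentLoop (a ∷ [])            i | _     = refl
inAscbot≡ascentLoop x@(a ∷ ys@(b ∷ bs)) i | loop≡ with x
... | _ with 2 | ys
... | j | ys = cong (λ r → (i ≡ᵇ 1) ∨ (((1 ≡ᵇ i) ∧ (a <ᵇ b)) ∨ r)) (loop≡ j ys)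

ascentLoop-past : ∀ {i j} ys → i < j → ascentLoop i j ys ≡ false
ascentLoop-past []           i<j = refl
ascentLoop-past (a ∷ [])     i<j = refl
ascentLoop-past (a ∷ b ∷ bs) i<j =
  cong₂ (λ u v → (u ∧ (a <ᵇ b)) ∨ v) (≡ᵇ-≢ (<⇒≢ i<j ∘ sym)) (ascentLoop-past (b ∷ bs) (m<n⇒m<1+n i<j))

ascentLoop-at : ∀ t j ys → ascentLoop (t + j) j ys ≡ ((suc t <ᵇ length ys) ∧ (ys ! t <ᵇ ys ! suc t))
ascentLoop-at t       j []           = refl
ascentLoop-at t       j (a ∷ [])     = refl
ascentLoop-at zero    j (a ∷ b ∷ bs)
  rewrite ≡ᵇ-refl j | ascentLoop-past {j} (b ∷ bs) ≤-refl = ∨-identityʳ (a <ᵇ b)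
ascentLoop-at (suc t) j (a ∷ b ∷ bs)
  rewrite ≡ᵇ-≢ {j} {suc t + j} (<⇒≢ (s≤s (m≤n+m j t))) | sym (+-suc t j) = ascentLoop-at t (suc j) (b ∷ bs)

nubLoop : ℕ → ℕ → List ℕ → List ℕ → Bool
nubLoop i j seen []       = false
nubLoop i j seen (a ∷ as) = ((j ≡ᵇ i) ∧ not (memb a seen)) ∨ nubLoop i (suc j) (a ∷ seen) as

nubLoop-unique : ∀ i (g : ℕ → List ℕ → List ℕ → Bool) →
  (∀ j seen → g j seen [] ≡ false) →
  (∀ j seen a as → g j seen (a ∷ as) ≡ (((j ≡ᵇ i) ∧ not (memb a seen)) ∨ g (suc j) (a ∷ seen) as)) →
  ∀ j seen ys → g j seen ys ≡ nubLoop i j seen ys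
nubLoop-unique i g e₀ e₁ j seen []       = e₀ j seen
nubLoop-unique i g e₀ e₁ j seen (a ∷ as) = trans (e₁ j seen a as)
  (cong (((j ≡ᵇ i) ∧ not (memb a seen)) ∨_) (nubLoop-unique i g e₀ e₁ (suc j) (a ∷ seen) as))

inNub≡nubLoop : ∀ x i → inNub x i ≡ nubLoop i 1 [] x
inNub≡nubLoop x i with nubLoop-unique i _ (λ _ _ → refl) (λ _ _ _ _ → refl)
inNub≡nubLoop []         i | _     = refl
inNub≡nubLoop x@(a ∷ as) i | loop≡ with x
... | _ with 2 | [ a ]
... | j | seen = cong (((1 ≡ᵇ i) ∧ true) ∨_) (loop≡ j seen as)

nubLoop-past : ∀ {i j} seen ys → i < j → nubLoop i j seen ys ≡ false
nubLoop-past seen []       i<j = refl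
nubLoop-past seen (a ∷ as) i<j =
  cong₂ (λ u v → (u ∧ not (memb a seen)) ∨ v) (≡ᵇ-≢ (<⇒≢ i<j ∘ sym))
        (nubLoop-past (a ∷ seen) as (m<n⇒m<1+n i<j))

nubLoop-at : ∀ t j seen ys → nubLoop (t + j) j seen ys ≡
  ((t <ᵇ length ys) ∧ not (memb (ys ! t) seen ∨ memb (ys ! t) (take t ys)))
nubLoop-at t       j seen []       = refl
nubLoop-at zero    j seen (a ∷ as)
  rewrite ≡ᵇ-refl j | nubLoop-past {j} (a ∷ seen) as ≤-refl | ∨-identityʳ (memb a seen) =
  ∨-identityʳ (not (memb a seen))
nubLoop-at (suc t) j seen (a ∷ as)
  rewrite ≡ᵇ-≢ {j} {suc t + j} (<⇒≢ (s≤s (m≤n+m j t))) | sym (+-suc t j)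
        | nubLoop-at t (suc j) (a ∷ seen) as =
  cong (λ b → (t <ᵇ length as) ∧ not b)
       (∨-rotate (as ! t ≡ᵇ a) (memb (as ! t) seen) (memb (as ! t) (take t as)))
  where
  ∨-rotate : ∀ p q r → ((p ∨ q) ∨ r) ≡ (q ∨ (p ∨ r))
  ∨-rotate p q r = trans (cong (_∨ r) (∨-comm p q)) (∨-assoc q p r)

position⇒∈-take : ∀ x {s t} → s < t → s < length x → x ! s ∈ take t x
position⇒∈-take (a ∷ x) {zero}  {suc t} _         _         = here refl
position⇒∈-take (a ∷ x) {suc s} {suc t} (s<s s<t) (s<s s<n) = there (position⇒∈-take x s<t s<n)

inAscbot-suc : ∀ x t → inAscbot x (suc t) ≡ ((t ≡ᵇ 0) ∨ ((suc t <ᵇ length x) ∧ (x ! t <ᵇ x ! suc t)))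
inAscbot-suc x t = trans (inAscbot≡ascentLoop x (suc t))
  (cong ((t ≡ᵇ 0) ∨_) (trans (cong (λ i → ascentLoop i 1 x) (+-comm 1 t)) (ascentLoop-at t 1 x)))

inNub-suc : ∀ x t → inNub x (suc t) ≡ ((t <ᵇ length x) ∧ not (memb (x ! t) (take t x)))
inNub-suc x t = trans (inNub≡nubLoop x (suc t))
  (trans (cong (λ i → nubLoop i 1 [] x) (+-comm 1 t)) (nubLoop-at t 1 [] x))

inAscbot-suc⇔ : ∀ x t → T (inAscbot x (suc t)) ⇔ (t ≡ 0 ⊎ Ascent x t)
inAscbot-suc⇔ x t rewrite inAscbot-suc x t = mk⇔
  (Sum.map (≡ᵇ⇒≡ t 0) (λ h → let t+1<n , x!t<x!t+1 = Equivalence.to T-∧ h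
                                  in <ᵇ⇒< _ _ t+1<n , <ᵇ⇒< _ _ x!t<x!t+1)
    ∘ Equivalence.to T-∨)
  (Equivalence.from T-∨ ∘ Sum.map (≡⇒≡ᵇ t 0) (λ (t+1<n , x!t<x!t+1) →
    Equivalence.from T-∧ (<⇒<ᵇ t+1<n , <⇒<ᵇ x!t<x!t+1)))

inNub-suc⇔ : ∀ x t → t < length x → T (inNub x (suc t)) ⇔ FirstOccurrence x t
inNub-suc⇔ x t t<n rewrite inNub-suc x t | <ᵇ-< t<n = mk⇔
  (λ x!t∉ s s<t x!s≡x!t →
    T-not⁻ x!t∉ (Equivalence.from memb⇔∈
      (subst (_∈ take t x) x!s≡x!t (position⇒∈-take x s<t (<-trans s<t t<n)))))
  (λ first → T-not⁺ λ x!t∈ → let s , s<t , x!s≡x!t = ∈-take⇒position x t (Equivalence.to memb⇔∈ x!t∈)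
                              in first s s<t x!s≡x!t)

-- Ascbot(x) = Nub(x), read at the 0-based position t.
RevisedAscent : List ℕ → Set
RevisedAscent x = ∀ t → t < length x → (t ≡ 0 ⊎ Ascent x t) ⇔ FirstOccurrence x t

ascbotEqNub⇒RevisedAscent : ∀ x → T (ascbotEqNub x) → RevisedAscent x
ascbotEqNub⇒RevisedAscent x h t t<n = mk⇔
  (Equivalence.to (inNub-suc⇔ x t t<n) ∘ subst T asc≡nub ∘ Equivalence.from (inAscbot-suc⇔ x t))
  (Equivalence.to (inAscbot-suc⇔ x t) ∘ subst T (sym asc≡nub) ∘ Equivalence.from (inNub-suc⇔ x t t<n))
  where
  asc≡nub : inAscbot x (suc t) ≡ inNub x (suc t)
  asc≡nub = T-does-≟⇒≡ (All.lookup (All.all⁺ (λ i → does (inAscbot x i Bool.≟ inNub x i)) _ h)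
                                  (∈-applyUpTo⁺ suc t<n))

RevisedAscent⇒ascbotEqNub : ∀ x → RevisedAscent x → T (ascbotEqNub x)
RevisedAscent⇒ascbotEqNub x ra = All.all⁻ (λ i → does (inAscbot x i Bool.≟ inNub x i))
  (All.tabulate λ i∈ → let t , t<n , i≡1+t = ∈-applyUpTo⁻ suc i∈ in
    subst (λ i → T (does (inAscbot x i Bool.≟ inNub x i))) (sym i≡1+t) (≡⇒T-does-≟ (T-⇔⇒≡
      (Equivalence.from (inNub-suc⇔ x t t<n) ∘ Equivalence.to (ra t t<n) ∘
       Equivalence.to (inAscbot-suc⇔ x t))
      (Equivalence.from (inAscbot-suc⇔ x t) ∘ Equivalence.from (ra t t<n) ∘
       Equivalence.to (inNub-suc⇔ x t t<n)))))

Cayley : List ℕ → Set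
Cayley x = ∀ v → InRange (maxL x) v → v ∈ x

isCayley⇒Cayley : ∀ x → T (isCayley x) → Cayley x
isCayley⇒Cayley x h v v∈ =
  Equivalence.to memb⇔∈ (All.lookup (All.all⁺ (λ v → memb v x) _ h) (∈-applyUpTo-suc⁺ v∈))

Cayley⇒isCayley : ∀ x → Cayley x → T (isCayley x)
Cayley⇒isCayley x c = All.all⁻ (λ v → memb v x)
  (All.tabulate λ v∈ → Equivalence.from memb⇔∈ (c _ (∈-applyUpTo-suc⁻ v∈)))

maxL-head : ∀ a w → All (_≤ a) w → maxL (a ∷ w) ≡ a
maxL-head a w w≤a = m≥n⇒m⊔n≡m (maxL≤ w w≤a)
  where
  maxL≤ : ∀ w → All (_≤ a) w → maxL w ≤ a
  maxL≤ []      []          = z≤n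
  maxL≤ (b ∷ w) (b≤a ∷ w≤a) = ⊔-lub b≤a (maxL≤ w w≤a)

subseqs-count : ∀ k x {y} v → y ∈ subseqs k x → count v y ≤ count v x
subseqs-count zero    x       v (here refl) = z≤n
subseqs-count (suc k) (a ∷ x) v y∈ with ∈-++⁻ (map (a ∷_) (subseqs k x)) y∈
subseqs-count (suc k) (a ∷ x) v y∈ | inj₁ a∷z∈ with ∈-map⁻ (a ∷_) a∷z∈
... | z , z∈ , refl with v ≟ a
...   | yes _ = s≤s (subseqs-count k x v z∈)
...   | no  _ = subseqs-count k x v z∈
subseqs-count (suc k) (a ∷ x) v y∈ | inj₂ y∈′ with v ≟ a
... | yes _ = m≤n⇒m≤1+n (subseqs-count (suc k) x v y∈′)
... | no  _ = subseqs-count (suc k) x v y∈′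

subseqs-pick : ∀ x {d t k ys} → d ≤ t → t < length x → ys ∈ subseqs k (drop (suc t) x) →
  (x ! t ∷ ys) ∈ subseqs (suc k) (drop d x)
subseqs-pick (a ∷ x) {zero}  {zero}  _         _         ys∈ = ∈-++⁺ˡ (∈-map⁺ (a ∷_) ys∈)
subseqs-pick (a ∷ x) {zero}  {suc t} {k} _ (s<s t<n) ys∈ =
  ∈-++⁺ʳ (map (a ∷_) (subseqs k x)) (subseqs-pick x z≤n t<n ys∈)
subseqs-pick (a ∷ x) {suc d} {suc t} (s≤s d≤t) (s<s t<n) ys∈ = subseqs-pick x d≤t t<n ys∈

positions⇒subseqs : ∀ x {f p r q} → f < p → p < r → r < q → q < length x →
  (x ! f ∷ x ! p ∷ x ! r ∷ x ! q ∷ []) ∈ subseqs 4 x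
positions⇒subseqs x f<p p<r r<q q<n =
  subseqs-pick x z≤n (<-trans f<p p<n)
    (subseqs-pick x f<p p<n
      (subseqs-pick x p<r r<n
        (subseqs-pick x r<q q<n (here refl))))
  where
  r<n = <-trans r<q q<n
  p<n = <-trans p<r r<n

pattern2121 : List ℕ
pattern2121 = 2 ∷ 1 ∷ 2 ∷ 1 ∷ []

-- The comparison local to `orderIso`, repeated so that `orderIso` on a word of length four can be
-- stated in unfolded form.
agree : ℕ × ℕ → ℕ × ℕ → Bool
agree (a , b) (c , d) = does ((a <ᵇ c) Bool.≟ (b <ᵇ d)) ∧ does ((a ≡ᵇ c) Bool.≟ (b ≡ᵇ d))

orderIso-2121 : ∀ y₁ y₂ y₃ y₄ → let ys = (y₁ , 2) ∷ (y₂ , 1) ∷ (y₃ , 2) ∷ (y₄ , 1) ∷ [] in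
  orderIso (y₁ ∷ y₂ ∷ y₃ ∷ y₄ ∷ []) pattern2121 ≡ all (λ p → all (agree p) ys) ys
orderIso-2121 y₁ y₂ y₃ y₄ = refl

orderIso-2121⁻ : ∀ y₁ y₂ y₃ y₄ → T (orderIso (y₁ ∷ y₂ ∷ y₃ ∷ y₄ ∷ []) pattern2121) →
  y₁ ≡ y₃ × y₂ ≡ y₄ × y₂ < y₁
orderIso-2121⁻ y₁ y₂ y₃ y₄ iso =
  ≡ᵇ⇒≡ y₁ y₃ (eq (proj₂ (Equivalence.to T-∧ (entry (y₁ , 2) first third)))) ,
  ≡ᵇ⇒≡ y₂ y₄ (eq (proj₂ (Equivalence.to T-∧ (entry (y₂ , 1) second fourth)))) ,
  <ᵇ⇒< y₂ y₁ (eq (proj₁ (Equivalence.to T-∧ (entry (y₂ , 1) second first))))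
  where
  ys = (y₁ , 2) ∷ (y₂ , 1) ∷ (y₃ , 2) ∷ (y₄ , 1) ∷ []
  rows : All (λ p → T (all (agree p) ys)) ys
  rows = All.all⁺ (λ p → all (agree p) ys) ys (subst T (orderIso-2121 y₁ y₂ y₃ y₄) iso)
  entry : ∀ p → p ∈ ys → ∀ {q} → q ∈ ys → T (agree p q)
  entry p p∈ = All.lookup (All.all⁺ (agree p) ys (All.lookup rows p∈))
  eq : ∀ {b} → T (does (b Bool.≟ true)) → T b
  eq b≡true = Equivalence.from T-≡ (T-does-≟⇒≡ b≡true)
  first : (y₁ , 2) ∈ ys
  first = here refl
  second : (y₂ , 1) ∈ ys
  second = there (here refl)
  third : (y₃ , 2) ∈ ys
  third = there (there (here refl))
  fourth : (y₄ , 1) ∈ ys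
  fourth = there (there (there (here refl)))

orderIso-2121⁺ : ∀ {a b} → a < b → T (orderIso (b ∷ a ∷ b ∷ a ∷ []) pattern2121)
orderIso-2121⁺ {a} {b} a<b
  rewrite <ᵇ-< a<b | <ᵇ-≥ (<⇒≤ a<b) | <ᵇ-≥ (≤-refl {a}) | <ᵇ-≥ (≤-refl {b})
        | ≡ᵇ-refl a | ≡ᵇ-refl b | ≡ᵇ-≢ (<⇒≢ a<b) | ≡ᵇ-≢ (<⇒≢ a<b ∘ sym) = _

Avoids2121 : List ℕ → Set
Avoids2121 x = ∀ {a b} → a < b → (b ∷ a ∷ b ∷ a ∷ []) ∉ subseqs 4 x

avoids⇒Avoids2121 : ∀ x → T (avoids x pattern2121) → Avoids2121 x
avoids⇒Avoids2121 x h a<b baba∈ =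
  T-not⁻ h (Any.any⁺ (λ y → orderIso y pattern2121) (lose baba∈ (orderIso-2121⁺ a<b)))

Avoids2121⇒avoids : ∀ x → Avoids2121 x → T (avoids x pattern2121)
Avoids2121⇒avoids x no2121 = T-not⁺ λ h →
  let y , y∈ , iso = find (Any.any⁻ (λ y → orderIso y pattern2121) (subseqs 4 x) h) in not-iso y y∈ iso
  where
  not-iso : ∀ y → y ∈ subseqs 4 x → ¬ T (orderIso y pattern2121)
  not-iso (y₁ ∷ y₂ ∷ y₃ ∷ y₄ ∷ []) y∈ iso with orderIso-2121⁻ y₁ y₂ y₃ y₄ iso
  ... | refl , refl , y₂<y₁ = no2121 y₂<y₁ y∈
  not-iso []                          _ ()
  not-iso (_ ∷ [])                    _ ()
  not-iso (_ ∷ _ ∷ [])                _ ()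
  not-iso (_ ∷ _ ∷ _ ∷ [])            _ ()
  not-iso (_ ∷ _ ∷ _ ∷ _ ∷ _ ∷ _)     _ ()

-- Block words

ClimbsTo : ℕ → List ℕ → Set
ClimbsTo M []          = ⊥
ClimbsTo M (b ∷ [])    = b ≡ M
ClimbsTo M (b ∷ c ∷ w) = (b ≡ M ⊎ b < c) × ClimbsTo M (c ∷ w)

ClimbsTo⁺ : ∀ M w → 1 ≤ length w → (∀ s → s < length w → w ! s ≢ M → Ascent w s) → ClimbsTo M w
ClimbsTo⁺ M (b ∷ [])    _ asc with b ≟ M
... | yes b≡M = b≡M
... | no  b≢M = ⊥-elim (<-irrefl refl (proj₁ (asc 0 z<s b≢M)))
ClimbsTo⁺ M (b ∷ c ∷ w) _ asc = step , ClimbsTo⁺ M (c ∷ w) (s≤s z≤n) λ s s<n w!s≢M →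
  let 2+s<n , w!s<w!s+1 = asc (suc s) (s<s s<n) w!s≢M in ≤-pred 2+s<n , w!s<w!s+1
  where
  step : b ≡ M ⊎ b < c
  step with b ≟ M
  ... | yes b≡M = inj₁ b≡M
  ... | no  b≢M = inj₂ (proj₂ (asc 0 z<s b≢M))

ClimbsTo⁻ : ∀ M w → ClimbsTo M w → ∀ s → s < length w → w ! s ≢ M → Ascent w s
ClimbsTo⁻ M (b ∷ [])    b≡M              zero    _         b≢M = ⊥-elim (b≢M b≡M)
ClimbsTo⁻ M (b ∷ [])    _                (suc s) (s<s ())  _
ClimbsTo⁻ M (b ∷ c ∷ w) (inj₁ b≡M , _)   zero    _         b≢M = ⊥-elim (b≢M b≡M)
ClimbsTo⁻ M (b ∷ c ∷ w) (inj₂ b<c , _)   zero    _         _   = s<s z<s , b<c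
ClimbsTo⁻ M (b ∷ c ∷ w) (_ , climbs)     (suc s) (s<s s<n) w!s≢M =
  let 2+s<n , w!s<w!s+1 = ClimbsTo⁻ M (c ∷ w) climbs s s<n w!s≢M in s<s 2+s<n , w!s<w!s+1

ClimbsTo-insert : ∀ {M v} w₁ {w₂} → v < M → All (λ b → b ≡ M ⊎ b < v) w₁ →
  ClimbsTo M (w₁ ++ M ∷ w₂) → ClimbsTo M (w₁ ++ v ∷ M ∷ w₂)
ClimbsTo-insert []           v<M []           climbs         = inj₂ v<M , climbs
ClimbsTo-insert (b ∷ [])     v<M (b<v ∷ [])   (_ , climbs)   = b<v , inj₂ v<M , climbs
ClimbsTo-insert (b ∷ c ∷ w₁) v<M (_ ∷ w₁<v)   (b<c , climbs) = b<c , ClimbsTo-insert (c ∷ w₁) v<M w₁<v climbs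

ClimbsTo-remove : ∀ {M v} w₁ {w₂} → v < M → ClimbsTo M (w₁ ++ v ∷ M ∷ w₂) → ClimbsTo M (w₁ ++ M ∷ w₂)
ClimbsTo-remove []           v<M (_ , climbs)                = climbs
ClimbsTo-remove (b ∷ [])     v<M (inj₁ b≡M , _ , climbs)     = inj₁ b≡M , climbs
ClimbsTo-remove (b ∷ [])     v<M (inj₂ b<v , _ , climbs)     = inj₂ (<-trans b<v v<M) , climbs
ClimbsTo-remove (b ∷ c ∷ w₁) v<M (b<c , climbs)              = b<c , ClimbsTo-remove (c ∷ w₁) v<M climbs

ClimbsTo-next : ∀ {M v} w₁ {w₂} → ClimbsTo M (w₁ ++ v ∷ w₂) → v ≢ M → ∃₂ λ c w₂′ → w₂ ≡ c ∷ w₂′ × v < c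
ClimbsTo-next []           {[]}     v≡M              v≢M = ⊥-elim (v≢M v≡M)
ClimbsTo-next []           {c ∷ w₂} (inj₁ v≡M , _)   v≢M = ⊥-elim (v≢M v≡M)
ClimbsTo-next []           {c ∷ w₂} (inj₂ v<c , _)   _   = c , w₂ , refl , v<c
ClimbsTo-next (b ∷ [])     (_ , climbs)              v≢M = ClimbsTo-next [] climbs v≢M
ClimbsTo-next (b ∷ c ∷ w₁) (_ , climbs)              v≢M = ClimbsTo-next (c ∷ w₁) climbs v≢M

ClimbsTo-replicate : ∀ M G → ClimbsTo M (replicate (suc G) M)
ClimbsTo-replicate M zero    = refl
ClimbsTo-replicate M (suc G) = inj₁ refl , ClimbsTo-replicate M G

ClimbsTo⇒∈ : ∀ M w → ClimbsTo M w → M ∈ w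
ClimbsTo⇒∈ M (b ∷ [])    refl         = here refl
ClimbsTo⇒∈ M (b ∷ c ∷ w) (_ , climbs) = there (ClimbsTo⇒∈ M (c ∷ w) climbs)

-- For M = k + 1 these are the tails of the sequences in
-- B̂(2121), and a block word with G blocks corresponds to a function from {1..k} to {1..G}.
record BlockWord (M k : ℕ) (w : List ℕ) : Set where
  field
    entries : All (λ b → b ≡ M ⊎ InRange k b) w
    once    : ∀ v → InRange k v → count v w ≡ 1
    climbs  : ClimbsTo M w

-- Characterisation of B̂(2121) by block words

module _ (x : List ℕ) (revised : RevisedAscent x) (avoiding : Avoids2121 x) where

  first-occurrence⇒ascent : ∀ {t} → 1 ≤ t → t < length x → FirstOccurrence x t → Ascent x t
  first-occurrence⇒ascent {suc t} _ t<n first with Equivalence.from (revised (suc t) t<n) first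
  ... | inj₂ ascent = ascent

  head-max : ∀ {hi} → length x ≡ suc hi → ∀ t → t ≤ hi → x ! t ≤ x ! 0
  head-max {hi} n≡1+hi t t≤hi with segment-argmax (x !_) 0 hi z≤n
  ... | r , _ , r≤hi , max with first-occurrence x r
  ... | zero  , _   , x!0≡x!r , _       = subst (x ! t ≤_) (sym x!0≡x!r) (max t z≤n t≤hi)
  ... | suc f , f≤r , x!f≡x!r , first-f =
    ⊥-elim (<-irrefl x!f≡x!r (<-≤-trans (proj₂ ascent) (max (suc (suc f)) z≤n 2+f≤hi)))
    where
    ascent = first-occurrence⇒ascent (s≤s z≤n) (subst (suc f <_) (sym n≡1+hi) (s≤s (≤-trans f≤r r≤hi)))
                                     first-f
    2+f≤hi = ≤-pred (subst (suc (suc f) <_) n≡1+hi (proj₁ ascent))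

  segment-max-first-occurrence : ∀ {lo hi r f} → 1 ≤ lo → r < hi → hi < length x →
    (∀ t → lo ≤ t → t ≤ hi → x ! t ≤ x ! r) →
    f ≤ r → x ! f ≡ x ! r → FirstOccurrence x f → f < lo
  segment-max-first-occurrence {lo} {f = f} 1≤lo r<hi hi<n max f≤r x!f≡x!r first-f with f <? lo
  ... | yes f<lo = f<lo
  ... | no  f≮lo = ⊥-elim (<-irrefl x!f≡x!r
    (<-≤-trans x!f<x!f+1 (max (suc f) (m≤n⇒m≤1+n lo≤f) (≤-trans (s≤s f≤r) r<hi))))
    where
    lo≤f = ≮⇒≥ f≮lo
    x!f<x!f+1 = proj₂ (first-occurrence⇒ascent (≤-trans 1≤lo lo≤f) (≤-<-trans f≤r (<-trans r<hi hi<n))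
                                                first-f)

  segment-peak : ∀ {s q} → s < q → q < length x → x ! q < x ! suc s →
    ∃ λ r → s < r × r < q × x ! q < x ! r × (∀ t → suc s ≤ t → t ≤ q → x ! t ≤ x ! r)
  segment-peak {s} {q} s<q q<n x!q<x!s+1 with segment-argmax (x !_) (suc s) q s<q
  ... | r , s<r , r≤q , max = r , s<r , ≤∧≢⇒< r≤q (λ { refl → <-irrefl refl x!q<x!r }) , x!q<x!r , max
    where x!q<x!r = <-≤-trans x!q<x!s+1 (max (suc s) ≤-refl s<q)

  first-occurrence-unrepeated : ∀ {s q} → 1 ≤ s → s < q → q < length x → x ! s ≡ x ! q →
    FirstOccurrence x s → ⊥
  first-occurrence-unrepeated {s} {q} 1≤s s<q q<n x!s≡x!q first-s
    with segment-peak s<q q<n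
           (subst (_< x ! suc s) x!s≡x!q (proj₂ (first-occurrence⇒ascent 1≤s (<-trans s<q q<n) first-s)))
  ... | r , s<r , r<q , a<b , max with first-occurrence x r
  ... | f , f≤r , x!f≡x!r , first-f
    with m≤n⇒m<n∨m≡n (m<1+n⇒m≤n (segment-max-first-occurrence (s≤s z≤n) r<q q<n max f≤r x!f≡x!r first-f))
  ... | inj₂ refl = <-irrefl (trans (sym x!s≡x!q) x!f≡x!r) a<b
  ... | inj₁ f<s  = avoiding a<b
    (subst (_∈ subseqs 4 x) (cong₂ (λ b a → b ∷ a ∷ x ! r ∷ x ! q ∷ []) x!f≡x!r x!s≡x!q)
      (positions⇒subseqs x f<s s<r r<q q<n))

  repeat⇒head : ∀ {p q} → p < q → q < length x → x ! p ≡ x ! q → x ! q ≡ x ! 0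
  repeat⇒head {p} p<q q<n x!p≡x!q with first-occurrence x p
  ... | zero  , _   , x!0≡x!p , _       = sym (trans x!0≡x!p x!p≡x!q)
  ... | suc s , s≤p , x!s≡x!p , first-s =
    ⊥-elim (first-occurrence-unrepeated (s≤s z≤n) (≤-<-trans s≤p p<q) q<n (trans x!s≡x!p x!p≡x!q)
                                        first-s)

avoiding⇒BlockWord : ∀ k w → 1 ≤ length w → All (1 ≤_) w → Cayley (suc k ∷ w) →
  RevisedAscent (suc k ∷ w) → Avoids2121 (suc k ∷ w) → BlockWord (suc k) k w
avoiding⇒BlockWord k w 1≤n w≥1 cayley revised avoiding = record
  { entries = All.zipWith entry (w≥1 , w≤M)
  ; once    = once
  ; climbs  = ClimbsTo⁺ (suc k) w 1≤n climbs
  }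
  where
  x = suc k ∷ w

  repeat⇒M : ∀ {p q} → p < q → q < length x → x ! p ≡ x ! q → x ! q ≡ suc k
  repeat⇒M = repeat⇒head x revised avoiding

  w≤M : All (_≤ suc k) w
  w≤M = All.tabulate λ b∈ → let s , s<n , w!s≡b = ∈⇒position b∈ in
    subst (_≤ suc k) w!s≡b (head-max x revised avoiding refl (suc s) s<n)

  entry : ∀ {b} → 1 ≤ b × b ≤ suc k → b ≡ suc k ⊎ InRange k b
  entry (1≤b , b≤M) = [ (λ b<M → inj₂ (1≤b , m<1+n⇒m≤n b<M)) , inj₁ ]′ (m≤n⇒m<n∨m≡n b≤M)

  once : ∀ v → InRange k v → count v w ≡ 1
  once v (1≤v , v≤k) = ≤-antisym (≮⇒≥ unrepeated) (∈⇒count>0 w v∈w)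
    where
    v≢M : v ≢ suc k
    v≢M v≡M = <-irrefl v≡M (s≤s v≤k)
    v∈w : v ∈ w
    v∈w with cayley v (1≤v , subst (v ≤_) (sym (maxL-head (suc k) w w≤M)) (m≤n⇒m≤1+n v≤k))
    ... | here v≡M  = ⊥-elim (v≢M v≡M)
    ... | there v∈w = v∈w
    unrepeated : ¬ (2 ≤ count v w)
    unrepeated 2≤count with count≥2⇒positions w 2≤count
    ... | p , q , p<q , q<n , w!p≡v , w!q≡v =
      v≢M (trans (sym w!q≡v) (repeat⇒M (s<s p<q) (s<s q<n) (trans w!p≡v (sym w!q≡v))))

  climbs : ∀ s → s < length w → w ! s ≢ suc k → Ascent w s
  climbs s s<n w!s≢M = map₁ ≤-pred (first-occurrence⇒ascent x revised avoiding (s≤s z≤n) (s<s s<n) first)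
    where
    first : FirstOccurrence x (suc s)
    first s′ s′<1+s x!s′≡w!s = w!s≢M (repeat⇒M s′<1+s (s<s s<n) x!s′≡w!s)

module _ {M k w} (block : BlockWord M k w) where
  open BlockWord block

  BlockWord-bounded : k < M → All (_≤ M) w
  BlockWord-bounded k<M = All.map [ ≤-reflexive , (λ (_ , b≤k) → ≤-trans b≤k (<⇒≤ k<M)) ]′ entries

  BlockWord-once : ∀ {v} → v ∈ w → v ≢ M → count v w ≡ 1
  BlockWord-once v∈w v≢M = [ ⊥-elim ∘ v≢M , once _ ]′ (All.lookup entries v∈w)

module _ {k w} (block : BlockWord (suc k) k w) where
  open BlockWord block

  private
    w≤M : All (_≤ suc k) w
    w≤M = BlockWord-bounded block ≤-refl

  BlockWord⇒Cayley : Cayley (suc k ∷ w)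
  BlockWord⇒Cayley v (1≤v , v≤max) with v ≟ suc k
  ... | yes refl = here refl
  ... | no  v≢M  = there (count>0⇒∈ w (≤-reflexive (sym (once v (1≤v , m<1+n⇒m≤n (≤∧≢⇒< v≤M v≢M))))))
    where v≤M = subst (v ≤_) (maxL-head (suc k) w w≤M) v≤max

  BlockWord⇒RevisedAscent : RevisedAscent (suc k ∷ w)
  BlockWord⇒RevisedAscent zero    _ = mk⇔ (λ _ _ ()) (λ _ → inj₁ refl)
  BlockWord⇒RevisedAscent (suc s) (s<s s<n) with w ! s ≟ suc k
  ... | yes w!s≡M = mk⇔
    (λ { (inj₂ (_ , w!s<w!s+1)) → ⊥-elim (<⇒≱ w!s<w!s+1 w!s+1≤w!s) })
    (λ first → ⊥-elim (first 0 z<s (sym w!s≡M)))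
    where w!s+1≤w!s = subst (w ! suc s ≤_) (sym w!s≡M) (All-!-≤ w w≤M (suc s))
  ... | no  w!s≢M = mk⇔ (λ _ → first) (λ _ → inj₂ (s<s 2+s<n , ascends))
    where
    2+s<n = proj₁ (ClimbsTo⁻ (suc k) w climbs s s<n w!s≢M)
    ascends = proj₂ (ClimbsTo⁻ (suc k) w climbs s s<n w!s≢M)
    first : FirstOccurrence (suc k ∷ w) (suc s)
    first zero     _          M≡w!s     = w!s≢M (sym M≡w!s)
    first (suc s′) (s<s s′<s) w!s′≡w!s = <-irrefl (sym (BlockWord-once block (!-∈ w s<n) w!s≢M))
      (positions⇒count≥2 w s′<s s<n w!s′≡w!s refl)

  BlockWord⇒Avoids2121 : Avoids2121 (suc k ∷ w)
  BlockWord⇒Avoids2121 {a} {b} a<b baba∈ = <-irrefl (sym (BlockWord-once block a∈w a≢M)) 2≤count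
    where
    x = suc k ∷ w
    b≤M : b ≤ suc k
    b≤M = All.lookup (≤-refl ∷ w≤M)
      (count>0⇒∈ x (≤-trans (∈⇒count>0 (b ∷ a ∷ b ∷ a ∷ []) (here refl)) (subseqs-count 4 x b baba∈)))
    a≢M : a ≢ suc k
    a≢M a≡M = <-irrefl a≡M (<-≤-trans a<b b≤M)
    2≤count : 2 ≤ count a w
    2≤count = subst (2 ≤_) (count-there w a≢M)
      (≤-trans (positions⇒count≥2 (b ∷ a ∷ b ∷ a ∷ []) {1} {3} (s<s z<s) (s<s (s<s (s<s z<s))) refl refl)
               (subseqs-count 4 x a baba∈))
    a∈w : a ∈ w
    a∈w = count>0⇒∈ w (≤-trans (s≤s z≤n) 2≤count)

BlockWord-replicate : ∀ M G → BlockWord M 0 (replicate (suc G) M)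
BlockWord-replicate M G = record
  { entries = All.replicate⁺ (suc G) (inj₁ refl)
  ; once    = λ { v (1≤v , v≤0) → ⊥-elim (<-irrefl refl (≤-trans 1≤v v≤0)) }
  ; climbs  = ClimbsTo-replicate M G
  }

BlockWord-entry-≢ : ∀ {M k b} → suc k < M → b ≡ M ⊎ InRange k b → suc k ≢ b
BlockWord-entry-≢ k<M (inj₁ refl)     refl = <-irrefl refl k<M
BlockWord-entry-≢ k<M (inj₂ (_ , b≤k)) refl = <-irrefl refl (s≤s b≤k)

BlockWord-insert : ∀ {M k} w₁ {w₂} → suc k < M → BlockWord M k (w₁ ++ M ∷ w₂) →
  BlockWord M (suc k) (w₁ ++ suc k ∷ M ∷ w₂)
BlockWord-insert {M} {k} w₁ {w₂} k<M block = record
  { entries = All-middle⁺ w₁ (inj₂ (s≤s z≤n , ≤-refl)) (All.map weaken entries)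
  ; once    = once′
  ; climbs  = ClimbsTo-insert w₁ k<M (All.map below (All.++⁻ˡ w₁ entries)) climbs
  }
  where
  open BlockWord block
  weaken : ∀ {b} → b ≡ M ⊎ InRange k b → b ≡ M ⊎ InRange (suc k) b
  weaken = Sum.map₂ (λ (1≤b , b≤k) → 1≤b , m≤n⇒m≤1+n b≤k)
  below : ∀ {b} → b ≡ M ⊎ InRange k b → b ≡ M ⊎ b < suc k
  below = Sum.map₂ (s≤s ∘ proj₂)
  once′ : ∀ v → InRange (suc k) v → count v (w₁ ++ suc k ∷ M ∷ w₂) ≡ 1
  once′ v (1≤v , v≤1+k) with v ≟ suc k
  ... | yes refl = trans (count-middle-here (suc k) w₁ (M ∷ w₂))
                         (cong suc (count≡0⁺ _ (All.map (BlockWord-entry-≢ k<M) entries)))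
  ... | no  v≢1+k = trans (count-middle w₁ (M ∷ w₂) v≢1+k) (once v (1≤v , m<1+n⇒m≤n (≤∧≢⇒< v≤1+k v≢1+k)))

BlockWord-remove : ∀ {M k} w₁ {w₂} → suc k < M → BlockWord M (suc k) (w₁ ++ suc k ∷ M ∷ w₂) →
  BlockWord M k (w₁ ++ M ∷ w₂)
BlockWord-remove {M} {k} w₁ {w₂} k<M block = record
  { entries = All.zipWith strengthen (All-middle⁻ w₁ entries , others≢)
  ; once    = λ v (1≤v , v≤k) → trans (sym (count-middle w₁ (M ∷ w₂) (<⇒≢ (s≤s v≤k))))
                                      (once v (1≤v , m≤n⇒m≤1+n v≤k))
  ; climbs  = ClimbsTo-remove w₁ k<M climbs
  }
  where
  open BlockWord block
  others≢ : All (suc k ≢_) (w₁ ++ M ∷ w₂)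
  others≢ = count≡0⁻ _ (suc-injective (trans (sym (count-middle-here (suc k) w₁ (M ∷ w₂)))
                                             (once (suc k) (s≤s z≤n , ≤-refl))))
  strengthen : ∀ {b} → (b ≡ M ⊎ InRange (suc k) b) × suc k ≢ b → b ≡ M ⊎ InRange k b
  strengthen (inj₁ b≡M , _)              = inj₁ b≡M
  strengthen (inj₂ (1≤b , b≤1+k) , 1+k≢b) = inj₂ (1≤b , m<1+n⇒m≤n (≤∧≢⇒< b≤1+k (1+k≢b ∘ sym)))

BlockWord-split : ∀ {M k w} → suc k < M → BlockWord M (suc k) w →
  ∃₂ λ w₁ w₂ → w ≡ w₁ ++ suc k ∷ M ∷ w₂ × All (suc k ≢_) w₁
BlockWord-split {M} {k} {w} k<M block
  with split-at-occurrence (suc k) 1 w (s≤s z≤n) (≤-reflexive (sym (once (suc k) (s≤s z≤n , ≤-refl))))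
  where open BlockWord block
... | w₁ , rest , refl , count≡ with ClimbsTo-next w₁ (BlockWord.climbs block) (<⇒≢ k<M)
... | c , w₂ , refl , 1+k<c with All.head (All.tail (All.++⁻ʳ w₁ (BlockWord.entries block)))
... | inj₁ refl          = w₁ , w₂ , refl , count≡0⁻ w₁ (suc-injective count≡)
... | inj₂ (_ , c≤1+k)   = ⊥-elim (<⇒≱ 1+k<c c≤1+k)

-- Encoding block words by their block assignments

-- The occurrences of M are counted from 1; for c = 0 nothing is inserted.
insertBefore : ℕ → ℕ → ℕ → List ℕ → List ℕ
insertBefore M c v []      = []
insertBefore M c v (b ∷ w) with M ≟ b | c
... | no  _ | _        = b ∷ insertBefore M c v w
... | yes _ | suc zero = v ∷ b ∷ w
... | yes _ | c′       = b ∷ insertBefore M (pred c′) v w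

insertBefore-split : ∀ M v w₁ w₂ → insertBefore M (suc (count M w₁)) v (w₁ ++ M ∷ w₂) ≡ w₁ ++ v ∷ M ∷ w₂
insertBefore-split M v [] w₂ with M ≟ M
... | yes _  = refl
... | no M≢M = ⊥-elim (M≢M refl)
insertBefore-split M v (b ∷ w₁) w₂ with M ≟ b
... | yes refl = cong (M ∷_) (insertBefore-split M v w₁ w₂)
... | no  _    = cong (b ∷_) (insertBefore-split M v w₁ w₂)

-- The block word whose value i lies in block g_i, where g = g_k ⋯ g_1 lists the blocks of
-- k, …, 1 (values are inserted in increasing order, each before the M closing its block).
encode : ℕ → ℕ → List ℕ → List ℕ
encode M G []      = replicate G M
encode M G (c ∷ g) = insertBefore M c (suc (length g)) (encode M G g)

before : ℕ → List ℕ → List ℕ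
before v []      = []
before v (b ∷ w) with v ≟ b
... | yes _ = []
... | no  _ = b ∷ before v w

remove : ℕ → List ℕ → List ℕ
remove v []      = []
remove v (b ∷ w) with v ≟ b
... | yes _ = w
... | no  _ = b ∷ remove v w

decode : ℕ → ℕ → List ℕ → List ℕ
decode M zero    w = []
decode M (suc k) w = suc (count M (before (suc k) w)) ∷ decode M k (remove (suc k) w)

length-decode : ∀ M k w → length (decode M k w) ≡ k
length-decode M zero    w = refl
length-decode M (suc k) w = cong suc (length-decode M k (remove (suc k) w))

before-split : ∀ {v} w₁ {w₂} → All (v ≢_) w₁ → before v (w₁ ++ v ∷ w₂) ≡ w₁
before-split {v} [] _ with v ≟ v
... | yes _  = refl
... | no v≢v = ⊥-elim (v≢v refl)
before-split {v} (b ∷ w₁) (v≢b ∷ v∉w₁) with v ≟ b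
... | yes v≡b = ⊥-elim (v≢b v≡b)
... | no  _   = cong (b ∷_) (before-split w₁ v∉w₁)

remove-split : ∀ {v} w₁ {w₂} → All (v ≢_) w₁ → remove v (w₁ ++ v ∷ w₂) ≡ w₁ ++ w₂
remove-split {v} [] _ with v ≟ v
... | yes _  = refl
... | no v≢v = ⊥-elim (v≢v refl)
remove-split {v} (b ∷ w₁) (v≢b ∷ v∉w₁) with v ≟ b
... | yes v≡b = ⊥-elim (v≢b v≡b)
... | no  _   = cong (b ∷_) (remove-split w₁ v∉w₁)

decode-split : ∀ M k w₁ w₂ → All (suc k ≢_) w₁ →
  decode M (suc k) (w₁ ++ suc k ∷ w₂) ≡ suc (count M w₁) ∷ decode M k (w₁ ++ w₂)
decode-split M k w₁ w₂ k∉w₁ =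
  cong₂ (λ u r → suc (count M u) ∷ decode M k r) (before-split w₁ k∉w₁) (remove-split w₁ k∉w₁)

encode-∷ : ∀ {M G c} g → 1 ≤ c → c ≤ G → count M (encode M G g) ≡ G →
  ∃₂ λ w₁ w₂ → encode M G g ≡ w₁ ++ M ∷ w₂ × encode M G (c ∷ g) ≡ w₁ ++ suc (length g) ∷ M ∷ w₂ ×
               suc (count M w₁) ≡ c
encode-∷ {M} {G} {c} g 1≤c c≤G count≡G
  with split-at-occurrence M c (encode M G g) 1≤c (subst (c ≤_) (sym count≡G) c≤G)
... | w₁ , w₂ , enc≡ , refl = w₁ , w₂ , enc≡ ,
  trans (cong (insertBefore M (suc (count M w₁)) (suc (length g))) enc≡) (insertBefore-split M _ w₁ w₂) , refl

encode-BlockWord : ∀ {M G} g → length g < M → 1 ≤ G → All (InRange G) g →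
  BlockWord M (length g) (encode M G g) × count M (encode M G g) ≡ G × length (encode M G g) ≡ length g + G
encode-BlockWord {M} {suc G} [] _ _ [] =
  BlockWord-replicate M G , count-replicate (suc G) M , length-replicate (suc G)
encode-BlockWord {M} {G} (c ∷ g) k<M 1≤G ((1≤c , c≤G) ∷ g∈)
  with encode-BlockWord g (<-trans (n<1+n _) k<M) 1≤G g∈
... | block , count≡G , length≡ with encode-∷ g 1≤c c≤G count≡G
... | w₁ , w₂ , enc≡ , enc∷≡ , _ rewrite enc∷≡ | enc≡ =
  BlockWord-insert w₁ k<M block ,
  trans (count-middle w₁ (M ∷ w₂) (<⇒≢ k<M ∘ sym)) count≡G ,
  trans (length-++-sucʳ w₁ _ (M ∷ w₂)) (cong suc length≡)

decode-encode : ∀ {M G} g → length g < M → 1 ≤ G → All (InRange G) g → decode M (length g) (encode M G g) ≡ g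
decode-encode [] _ _ _ = refl
decode-encode {M} {G} (c ∷ g) k<M 1≤G ((1≤c , c≤G) ∷ g∈)
  with encode-BlockWord g (<-trans (n<1+n _) k<M) 1≤G g∈
... | block , count≡G , _ with encode-∷ g 1≤c c≤G count≡G
... | w₁ , w₂ , enc≡ , enc∷≡ , c≡ rewrite enc∷≡ = begin
  decode M (suc k) (w₁ ++ suc k ∷ M ∷ w₂)       ≡⟨ decode-split M k w₁ (M ∷ w₂) k∉w₁ ⟩
  suc (count M w₁) ∷ decode M k (w₁ ++ M ∷ w₂)  ≡⟨ cong₂ _∷_ c≡ (cong (decode M k) (sym enc≡)) ⟩
  c ∷ decode M k (encode M G g)                 ≡⟨ cong (c ∷_) (decode-encode g k<M′ 1≤G g∈) ⟩
  c ∷ g                                         ∎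
  where
  open ≡-Reasoning
  k = length g
  k<M′ = <-trans (n<1+n k) k<M
  k∉w₁ : All (suc k ≢_) w₁
  k∉w₁ = All.++⁻ˡ w₁ (subst (All (suc k ≢_)) enc≡ (All.map (BlockWord-entry-≢ k<M) (BlockWord.entries block)))

decode-∷ : ∀ {M k w} → suc k < M → BlockWord M (suc k) w →
  ∃₂ λ w₁ w₂ → w ≡ w₁ ++ suc k ∷ M ∷ w₂ × BlockWord M k (w₁ ++ M ∷ w₂) ×
               decode M (suc k) w ≡ suc (count M w₁) ∷ decode M k (w₁ ++ M ∷ w₂)
decode-∷ {M} {k} k<M block with BlockWord-split k<M block
... | w₁ , w₂ , refl , k∉w₁ =
  w₁ , w₂ , refl , BlockWord-remove w₁ k<M block , decode-split M k w₁ (M ∷ w₂) k∉w₁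

count-remove : ∀ {M k} w₁ w₂ → suc k < M → count M (w₁ ++ M ∷ w₂) ≡ count M (w₁ ++ suc k ∷ M ∷ w₂)
count-remove w₁ w₂ k<M = sym (count-middle w₁ _ (<⇒≢ k<M ∘ sym))

replicate-count : ∀ {M} w → All (_≡ M) w → replicate (count M w) M ≡ w
replicate-count []      []           = refl
replicate-count (b ∷ w) (refl ∷ w≡) rewrite count-here b w = cong (b ∷_) (replicate-count w w≡)

encode-decode : ∀ {M} k w → k < M → BlockWord M k w → encode M (count M w) (decode M k w) ≡ w
encode-decode {M} zero w _ block = replicate-count w (All.map only-M (BlockWord.entries block))
  where
  only-M : ∀ {b} → b ≡ M ⊎ InRange 0 b → b ≡ M
  only-M (inj₁ b≡M)         = b≡M
  only-M (inj₂ (1≤b , b≤0)) = ⊥-elim (<-irrefl refl (≤-trans 1≤b b≤0))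
encode-decode {M} (suc k) w k<M block with decode-∷ k<M block
... | w₁ , w₂ , refl , block′ , decode≡ = begin
  encode M G (decode M (suc k) w)               ≡⟨ cong (encode M G) decode≡ ⟩
  encode M G (suc (count M w₁) ∷ g′)
    ≡⟨ cong₂ (insertBefore M _) (cong suc (length-decode M k w′)) encode-g′ ⟩
  insertBefore M (suc (count M w₁)) (suc k) w′  ≡⟨ insertBefore-split M (suc k) w₁ w₂ ⟩
  w                                             ∎
  where
  open ≡-Reasoning
  w′ = w₁ ++ M ∷ w₂
  G  = count M w
  g′ = decode M k w′
  encode-g′ : encode M G g′ ≡ w′
  encode-g′ = subst (λ G → encode M G g′ ≡ w′) (count-remove w₁ w₂ k<M)
    (encode-decode k w′ (<-trans (n<1+n k) k<M) block′)

decode-InRange : ∀ {M} k w → k < M → BlockWord M k w → All (InRange (count M w)) (decode M k w)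
decode-InRange zero w _ _ = []
decode-InRange {M} (suc k) w k<M block with decode-∷ k<M block
... | w₁ , w₂ , refl , block′ , decode≡ rewrite decode≡ | sym (count-remove {k = k} w₁ w₂ k<M) =
  (s≤s z≤n , block-index≤) ∷ decode-InRange k (w₁ ++ M ∷ w₂) (<-trans (n<1+n k) k<M) block′
  where
  block-index≤ : suc (count M w₁) ≤ count M (w₁ ++ M ∷ w₂)
  block-index≤ = subst (suc (count M w₁) ≤_) (sym (count-middle-here M w₁ w₂))
    (s≤s (subst (count M w₁ ≤_) (sym (count-++ M w₁ w₂)) (m≤m+n (count M w₁) (count M w₂))))

BlockWord-length : ∀ {M k w} → k < M → BlockWord M k w → length w ≡ k + count M w
BlockWord-length {M} {k} {w} k<M block = begin
  length w                       ≡⟨ cong length (encode-decode k w k<M block) ⟨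
  length (encode M G g)          ≡⟨ proj₂ (proj₂ (encode-BlockWord g g<M 1≤G g∈)) ⟩
  length g + G                   ≡⟨ cong (_+ G) (length-decode M k w) ⟩
  k + G                          ∎
  where
  open ≡-Reasoning
  G = count M w
  g = decode M k w
  g<M = subst (_< M) (sym (length-decode M k w)) k<M
  1≤G = ∈⇒count>0 w (ClimbsTo⇒∈ M w (BlockWord.climbs block))
  g∈  = decode-InRange k w k<M block

-- Counting

isRevisedAvoiding2121 : List ℕ → Bool
isRevisedAvoiding2121 x = isRevisedAscentSeq x ∧ avoids x pattern2121

∈-Bhat⁻ : ∀ {n x} → x ∈ Bhat n pattern2121 →
  (length x ≡ n × All (InRange n) x) × T (isRevisedAvoiding2121 x)
∈-Bhat⁻ {n} x∈ with ∈-filter⁻ (Bool.T? ∘ isRevisedAvoiding2121) {xs = Endo n} x∈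
... | x∈Endo , holds = ∈-words⁻ n n x∈Endo , holds

∈-Bhat⁺ : ∀ {n} x → length x ≡ n → All (InRange n) x → T (isRevisedAvoiding2121 x) →
  x ∈ Bhat n pattern2121
∈-Bhat⁺ x refl x∈ holds = ∈-filter⁺ (Bool.T? ∘ isRevisedAvoiding2121) (∈-words⁺ x x∈) holds

Unique-Bhat : ∀ n → Unique (Bhat n pattern2121)
Unique-Bhat n = Unique.filter⁺ (Bool.T? ∘ isRevisedAvoiding2121) (Unique-words n n)

Bhat⇒BlockWord : ∀ {n x} → 2 ≤ n → x ∈ Bhat n pattern2121 →
  ∃₂ λ k w → x ≡ suc k ∷ w × suc (length w) ≡ n × BlockWord (suc k) k w
Bhat⇒BlockWord {n} {[]} 2≤n x∈ with ∈-Bhat⁻ {n} x∈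
... | (refl , _) , _ = ⊥-elim (<-irrefl refl (≤-trans (s≤s z≤n) 2≤n))
Bhat⇒BlockWord {n} {suc k ∷ w} 2≤n x∈ with ∈-Bhat⁻ {n} x∈
... | (refl , _ ∷ w∈) , holds = k , w , refl , refl ,
  avoiding⇒BlockWord k w (≤-pred 2≤n) (All.map proj₁ w∈)
    (isCayley⇒Cayley x (proj₁ revised)) (ascbotEqNub⇒RevisedAscent x (proj₂ revised))
    (avoids⇒Avoids2121 x (proj₂ (Equivalence.to T-∧ holds)))
  where
  x = suc k ∷ w
  revised = Equivalence.to T-∧ (proj₁ (Equivalence.to T-∧ holds))
Bhat⇒BlockWord {n} {zero ∷ w} 2≤n x∈ with ∈-Bhat⁻ {n} x∈
... | (_ , (() , _) ∷ _) , _

BlockWord⇒Bhat : ∀ {k w} → BlockWord (suc k) k w → (suc k ∷ w) ∈ Bhat (suc (length w)) pattern2121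
BlockWord⇒Bhat {k} {w} block = ∈-Bhat⁺ (suc k ∷ w) refl
  ((s≤s z≤n , M≤n) ∷ All.map in-range (BlockWord.entries block))
  (Equivalence.from T-∧ (Equivalence.from T-∧
    (Cayley⇒isCayley x (BlockWord⇒Cayley block) ,
     RevisedAscent⇒ascbotEqNub x (BlockWord⇒RevisedAscent block)) ,
    Avoids2121⇒avoids x (BlockWord⇒Avoids2121 block)))
  where
  x = suc k ∷ w
  M≤n : suc k ≤ suc (length w)
  M≤n = s≤s (subst (k ≤_) (sym (BlockWord-length ≤-refl block)) (m≤m+n k _))
  in-range : ∀ {b} → b ≡ suc k ⊎ InRange k b → InRange (suc (length w)) b
  in-range (inj₁ refl)         = s≤s z≤n , M≤n
  in-range (inj₂ (1≤b , b≤k)) = 1≤b , ≤-trans (m≤n⇒m≤1+n b≤k) M≤n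

-- The sequences M w of B̂_n(2121) whose tail w has G blocks, so that M = n ∸ G.
blocksOf : ℕ → ℕ → List (List ℕ)
blocksOf n G = map (λ g → (n ∸ G) ∷ encode (n ∸ G) G g) (words (n ∸ G ∸ 1) G)

bhat2121 : ℕ → List (List ℕ)
bhat2121 n = concatMap (blocksOf n) (applyUpTo suc (n ∸ 1))

length-bhat2121 : ∀ n → length (bhat2121 n) ≡ sumFrom1 (n ∸ 1) (λ G → G ^ (n ∸ G ∸ 1))
length-bhat2121 n = begin
  length (bhat2121 n)
    ≡⟨ length-concatMap (blocksOf n) (applyUpTo suc (n ∸ 1)) ⟩
  sum (map (length ∘ blocksOf n) (applyUpTo suc (n ∸ 1)))
    ≡⟨ cong sum (map-cong length-blocksOf (applyUpTo suc (n ∸ 1))) ⟩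
  sum (map (λ G → G ^ (n ∸ G ∸ 1)) (applyUpTo suc (n ∸ 1)))
    ≡⟨ cong sum (map-applyUpTo suc (λ G → G ^ (n ∸ G ∸ 1)) (n ∸ 1)) ⟩
  sumFrom1 (n ∸ 1) (λ G → G ^ (n ∸ G ∸ 1))  ∎
  where
  open ≡-Reasoning
  length-blocksOf : ∀ G → length (blocksOf n G) ≡ G ^ (n ∸ G ∸ 1)
  length-blocksOf G = trans (length-map _ (words (n ∸ G ∸ 1) G)) (length-words (n ∸ G ∸ 1) G)

blocksOf-suc : ∀ k G → blocksOf (suc (k + G)) G ≡ map (λ g → suc k ∷ encode (suc k) G g) (words k G)
blocksOf-suc k G rewrite m+n∸n≡m (suc k) G = refl

block-count-bounds : ∀ {n G} → G ∈ applyUpTo suc (n ∸ 1) → ∃ λ k → n ≡ suc (k + G) × 1 ≤ G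
block-count-bounds {suc n} {G} G∈ with ∈-applyUpTo-suc⁻ G∈
... | 1≤G , G≤n = n ∸ G , cong suc (sym (m∸n+n≡m G≤n)) , 1≤G

BlockWord∈blocksOf : ∀ {k w} → let G = count (suc k) w in
  BlockWord (suc k) k w → (suc k ∷ w) ∈ blocksOf (suc (k + G)) G
BlockWord∈blocksOf {k} {w} block = subst ((suc k ∷ w) ∈_) (sym (blocksOf-suc k G))
  (subst (λ w′ → (suc k ∷ w′) ∈ map (λ g → suc k ∷ encode (suc k) G g) (words k G))
    (encode-decode k w ≤-refl block) (∈-map⁺ (λ g → suc k ∷ encode (suc k) G g) g∈))
  where
  G = count (suc k) w
  g∈ : decode (suc k) k w ∈ words k G
  g∈ = subst (λ k′ → decode (suc k) k w ∈ words k′ G) (length-decode (suc k) k w)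
    (∈-words⁺ _ (decode-InRange k w ≤-refl block))

Bhat⊆bhat2121 : ∀ {n} → 2 ≤ n → Bhat n pattern2121 ⊆ bhat2121 n
Bhat⊆bhat2121 {n} 2≤n x∈ with Bhat⇒BlockWord {n} 2≤n x∈
... | k , w , refl , refl , block = ∈-concatMap⁺ (blocksOf (suc (length w))) (lose G∈ x∈blocks)
  where
  G = count (suc k) w
  length≡ : length w ≡ k + G
  length≡ = BlockWord-length ≤-refl block
  G∈ : G ∈ applyUpTo suc (length w)
  G∈ = ∈-applyUpTo-suc⁺ (∈⇒count>0 w (ClimbsTo⇒∈ (suc k) w (BlockWord.climbs block)) ,
                         subst (G ≤_) (sym length≡) (m≤n+m G k))
  x∈blocks : (suc k ∷ w) ∈ blocksOf (suc (length w)) G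
  x∈blocks = subst (λ m → (suc k ∷ w) ∈ blocksOf (suc m) G) (sym length≡) (BlockWord∈blocksOf block)

bhat2121⊆Bhat : ∀ {n} → bhat2121 n ⊆ Bhat n pattern2121
bhat2121⊆Bhat {n} z∈ with find (∈-concatMap⁻ (blocksOf n) {xs = applyUpTo suc (n ∸ 1)} z∈)
... | G , G∈ , z∈blocks with block-count-bounds {n} G∈
... | k , refl , 1≤G
  with ∈-map⁻ (λ g → suc k ∷ encode (suc k) G g) (subst (_ ∈_) (blocksOf-suc k G) z∈blocks)
... | g , g∈ , refl with ∈-words⁻ k G g∈
... | refl , g-in-range with encode-BlockWord {suc (length g)} g ≤-refl 1≤G g-in-range
... | block , _ , length≡ =
  subst (λ m → (suc (length g) ∷ encode (suc (length g)) G g) ∈ Bhat m pattern2121) (cong suc length≡)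
    (BlockWord⇒Bhat block)

decode-encode-words : ∀ {k G g} → 1 ≤ G → g ∈ words k G → decode (suc k) k (encode (suc k) G g) ≡ g
decode-encode-words {k} {G} {g} 1≤G g∈ with ∈-words⁻ k G g∈
... | refl , g-in-range = decode-encode g ≤-refl 1≤G g-in-range

Unique-bhat2121 : ∀ n → Unique (bhat2121 n)
Unique-bhat2121 n = Unique-concatMap⁺ unique-blocks disjoint
  (Unique.applyUpTo⁺₁ suc (n ∸ 1) (λ i<j _ → <⇒≢ i<j ∘ suc-injective))
  where
  unique-blocks : ∀ {G} → G ∈ applyUpTo suc (n ∸ 1) → Unique (blocksOf n G)
  unique-blocks {G} G∈ with block-count-bounds {n} G∈
  ... | k , refl , 1≤G = subst Unique (sym (blocksOf-suc k G)) (Unique-map⁺ injective (Unique-words k G))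
    where
    injective : ∀ {g g′} → g ∈ words k G → g′ ∈ words k G →
      suc k ∷ encode (suc k) G g ≡ suc k ∷ encode (suc k) G g′ → g ≡ g′
    injective g∈ g′∈ e = trans (sym (decode-encode-words 1≤G g∈))
      (trans (cong (decode (suc k) k) (proj₂ (∷-injective e))) (decode-encode-words 1≤G g′∈))

  G≤n : ∀ {G} → G ∈ applyUpTo suc (n ∸ 1) → G ≤ n
  G≤n G∈ = ≤-trans (proj₂ (∈-applyUpTo-suc⁻ G∈)) (m∸n≤m n 1)

  disjoint : ∀ {G G′ z} → G ∈ applyUpTo suc (n ∸ 1) → G′ ∈ applyUpTo suc (n ∸ 1) →
    z ∈ blocksOf n G → z ∈ blocksOf n G′ → G ≡ G′
  disjoint {G} {G′} G∈ G′∈ z∈ z∈′ with ∈-map⁻ _ z∈ | ∈-map⁻ _ z∈′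
  ... | _ , _ , refl | _ , _ , z≡ = begin
    G             ≡⟨ m∸[m∸n]≡n (G≤n G∈) ⟨
    n ∸ (n ∸ G)   ≡⟨ cong (n ∸_) (proj₁ (∷-injective z≡)) ⟩
    n ∸ (n ∸ G′)  ≡⟨ m∸[m∸n]≡n (G≤n G′∈) ⟩
    G′            ∎
    where open ≡-Reasoning

mainTheorem11 : ∀ (n : ℕ) → 2 ≤ n →
    length (Bhat n (2 ∷ 1 ∷ 2 ∷ 1 ∷ [])) ≡ sumFrom1 (n ∸ 1) (λ k → k ^ (n ∸ k ∸ 1))
mainTheorem11 n 2≤n = begin
  length (Bhat n pattern2121)  ≡⟨ Unique-⊆-antisym⇒length≡ (Unique-Bhat n) (Unique-bhat2121 n)
                                    (Bhat⊆bhat2121 2≤n) (bhat2121⊆Bhat {n}) ⟩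
  length (bhat2121 n)          ≡⟨ length-bhat2121 n ⟩
  sumFrom1 (n ∸ 1) (λ k → k ^ (n ∸ k ∸ 1))  ∎
  where open ≡-Reasoning
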